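{- Let $n\geq 4$ and $1\leq k\leq 3$ be integers. Let $G$ be a graph whose vertex set is partitioned into three subsets $V_{1}$, $V_{2}$, $V_{3}$ such that the induced subgraphs $G[V_{1}]$ and $G[V_{2}]$ are both complete graphs $K_{4n-k}$. Suppose the independence number of $G$ is at most two and $G$ contains no subgraph isomorphic to $F_{4,n}$. Then every vertex $w\in V_{3}$ is adjacent to all vertices of $V_{1}$ or to all vertices of $V_{2}$.
   Context: The generalized fan $F_{4,n}$ is $K_1+nK_4$, the join of a single vertex with the disjoint union of $n$ copies of $K_4$. -}

module Defs where

open import Level using (0ℓ)
open import Data.Nat using (ℕ; suc)
open import Data.Fin using (Fin; zero; suc; _≟_)
open import Data.List using (List; length; filter)
open import Data.List.Base using (allFin)
open import Data.Product using (Σ; _×_)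
open import Data.Sum using (_⊎_)
open import Data.Unit using (⊤; tt)
open import Relation.Binary.PropositionalEquality using (_≡_)
open import Relation.Nullary using (¬_)
open import Function.Definitions using (Injective)

record Graph (N : ℕ) : Set₁ where
  field
    Adj     : Fin N → Fin N → Set
    sym     : ∀ {u v} → Adj u v → Adj v u
    irrefl  : ∀ {v} → ¬ Adj v v
open Graph public

IndepAtMost2 : ∀ {N} → Graph N → Set
IndepAtMost2 {N} G = ∀ (a b c : Fin N) → ¬ a ≡ b → ¬ a ≡ c → ¬ b ≡ c →
  Adj G a b ⊎ Adj G a c ⊎ Adj G b c

-- Generalized fan F_{4,n} = K_1 + n K_4.
-- Vertices: the centre (inj₁ tt) and (i , j) : copy i ∈ Fin n, position j ∈ Fin 4.
FanV : ℕ → Set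
FanV n = ⊤ ⊎ (Fin n × Fin 4)

data FanAdj {n : ℕ} : FanV n → FanV n → Set where
  centre-l : ∀ {x} → FanAdj (_⊎_.inj₁ tt) (_⊎_.inj₂ x)
  centre-r : ∀ {x} → FanAdj (_⊎_.inj₂ x) (_⊎_.inj₁ tt)
  clique   : ∀ {i j j'} → ¬ j ≡ j' →
             FanAdj (_⊎_.inj₂ (i Data.Product., j)) (_⊎_.inj₂ (i Data.Product., j'))

ContainsFan : ∀ {N} → Graph N → ℕ → Set
ContainsFan {N} G n = Σ (FanV n → Fin N) λ f →
  Injective _≡_ _≡_ f × (∀ x y → FanAdj x y → Adj G (f x) (f y))

classSize : ∀ {N} → (Fin N → Fin 3) → Fin 3 → ℕ
classSize {N} part i = length (filter (λ v → part v ≟ i) (allFin N))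

InducesComplete : ∀ {N} → Graph N → (Fin N → Fin 3) → Fin 3 → ℕ → Set
InducesComplete {N} G part i m =
  classSize part i ≡ m ×
  (∀ (u v : Fin N) → part u ≡ i → part v ≡ i → ¬ u ≡ v → Adj G u v)

-- Let A ⊆ V₁ and B ⊆ V₂ be the non-neighbours of w. Since α(G) ≤ 2, every a ∈ A is
-- adjacent to every b ∈ B, as otherwise w, a, b would be independent. If A and B are both
-- non-empty, an F_{4,n} appears. When |B| ≥ 4, centre it at a ∈ A: V₁ ∖ {a} has at least
-- 4n − 4 vertices and yields n − 1 disjoint K₄'s, and B yields one more. When |A| ≥ 4 the
-- same works symmetrically. Otherwise w has at least 4n − 6 ≥ 4(n − 2) neighbours in V₁
-- and at least 4n − 6 ≥ 8 in V₂, and the fan is centred at w.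
module Submission where

open import Level using (0ℓ)
open import Data.Bool using (T)
open import Data.Bool.Properties using (T?)
open import Data.Empty using (⊥-elim)
open import Data.Fin using (Fin; zero; suc; _≟_; inject≤; combine; splitAt; punchIn)
open import Data.Fin.Properties
  using (inject≤-injective; combine-injective; +↔⊎; punchIn-injective; punchInᵢ≢i)
open import Data.List using (List; []; _∷_; length; filter; lookup)
open import Data.List.Base using (allFin)
open import Data.List.Membership.Propositional.Properties
  using (∈-allFin; ∈-filter⁻; ∈-filter⁺; ∈-lookup)
open import Data.List.Relation.Unary.All as All using ()
open import Data.List.Relation.Unary.AllPairs using (_∷_)
open import Data.List.Relation.Unary.Any as Any using (Any; any?; satisfied)
open import Data.List.Membership.Propositional using (lose)
open import Data.List.Relation.Unary.Any.Properties using (lookup-index)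
open import Data.List.Relation.Unary.Unique.Propositional using (Unique)
open import Data.List.Relation.Unary.Unique.Propositional.Properties using (allFin⁺; filter⁺)
open import Data.Maybe using (Maybe; just; nothing; is-just; to-witness-T; _>>=_)
open import Data.Nat using (ℕ; suc; _≤_; _*_; _∸_; _+_; pred; _≤?_; s≤s; s≤s⁻¹)
open import Data.Nat.Properties
  using (+-suc; +-comm; ≤-trans; ≤-reflexive; +-cancelˡ-≤; +-monoʳ-≤; ∸-monoʳ-≤; m+n∸m≡n;
         m≤n+m; *-monoˡ-≤; pred-mono-≤; ≰⇒>; ≤-refl; module ≤-Reasoning)
open import Data.Nat.Tactic.RingSolver using (solve-∀)
open import Data.Product using (∃; _×_; _,_; proj₁; proj₂; map₁)
open import Data.Product.Properties using (,-injectiveˡ; ,-injectiveʳ)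
open import Data.Sum using (_⊎_; inj₁; inj₂; isInj₁; isInj₂)
open import Data.Unit using (tt)
open import Function using (_∘_)
open import Function.Bundles using (Injection)
open import Function.Definitions using (Injective)
open import Function.Properties.Inverse using (↔⇒↣)
open import Relation.Binary using (Rel)
open import Relation.Binary.PropositionalEquality
  using (_≡_; _≢_; refl; sym; trans; cong; cong₂; subst)
open import Relation.Nullary using (¬_; Dec; yes; no; contradiction)
open import Relation.Nullary.Decidable using (decidable-stable)
open import Relation.Unary using (Pred; Decidable; ∁; _∩_)
open import Relation.Unary.Properties using (_∩?_; ∁?)

open import Defs hiding (sym)

private
  variable
    N s t p q : ℕ
    I J : Set
    X Y : Pred (Fin N) 0ℓ

Unique⇒lookup-injective : {A : Set} {xs : List A} → Unique xs → Injective _≡_ _≡_ (lookup xs)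
Unique⇒lookup-injective (_ ∷ _)    {zero}  {zero}  _  = refl
Unique⇒lookup-injective (x∉xs ∷ _) {zero}  {suc j} eq = ⊥-elim (All.lookup x∉xs (∈-lookup j) eq)
Unique⇒lookup-injective (x∉xs ∷ _) {suc i} {zero}  eq = ⊥-elim (All.lookup x∉xs (∈-lookup i) (sym eq))
Unique⇒lookup-injective (_ ∷ uniq) {suc i} {suc j} eq = cong suc (Unique⇒lookup-injective uniq eq)

length-filter-split : {A : Set} {P Q : Pred A 0ℓ} (P? : Decidable P) (Q? : Decidable Q) →
  ∀ xs →
  length (filter P? xs) ≡ length (filter (P? ∩? Q?) xs) + length (filter (P? ∩? ∁? Q?) xs)
length-filter-split P? Q? [] = refl
length-filter-split P? Q? (x ∷ xs) with P? x | Q? x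
... | yes _ | yes _ = cong suc (length-filter-split P? Q? xs)
... | yes _ | no _  = trans (cong suc (length-filter-split P? Q? xs)) (sym (+-suc _ _))
... | no _  | _     = length-filter-split P? Q? xs

count : {N : ℕ} {X : Pred (Fin N) 0ℓ} → Decidable X → ℕ
count {N} X? = length (filter X? (allFin N))

count-split : {N : ℕ} {X P : Pred (Fin N) 0ℓ} (X? : Decidable X) (P? : Decidable P) →
  count X? ≡ count (X? ∩? P?) + count (X? ∩? ∁? P?)
count-split {N} X? P? = length-filter-split X? P? (allFin N)

module Enumeration {N : ℕ} {X : Pred (Fin N) 0ℓ} (X? : Decidable X) where

  enumerate : Fin (count X?) → Fin N
  enumerate = lookup (filter X? (allFin N))

  enumerate-injective : Injective _≡_ _≡_ enumerate
  enumerate-injective = Unique⇒lookup-injective (filter⁺ X? (allFin⁺ N))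

  enumerate-∈ : ∀ i → X (enumerate i)
  enumerate-∈ i = proj₂ (∈-filter⁻ X? {xs = allFin N} (∈-lookup i))

  enumerate-surjective : ∀ {v} → X v → ∃ λ i → enumerate i ≡ v
  enumerate-surjective v∈X = Any.index v∈xs , sym (lookup-index v∈xs)
    where v∈xs = ∈-filter⁺ X? (∈-allFin _) v∈X

open Enumeration

adjacent⇒≢ : (G : Graph N) {u v : Fin N} → Adj G u v → u ≢ v
adjacent⇒≢ G u~v refl = irrefl G u~v

IsClique : Graph N → Pred (Fin N) 0ℓ → Set
IsClique G X = ∀ {u v} → X u → X v → u ≢ v → Adj G u v

record Clique (G : Graph N) (s : ℕ) : Set where
  field
    vertex    : Fin s → Fin N
    injective : Injective _≡_ _≡_ vertex
    adjacent  : ∀ {i j} → i ≢ j → Adj G (vertex i) (vertex j)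
open Clique

cliqueOf : {G : Graph N} (X? : Decidable X) → IsClique G X → Clique G (count X?)
cliqueOf X? X-clique = record
  { vertex    = enumerate X?
  ; injective = enumerate-injective X?
  ; adjacent  = λ i≢j →
      X-clique (enumerate-∈ X? _) (enumerate-∈ X? _) (i≢j ∘ enumerate-injective X?)
  }

delete : {G : Graph N} → Clique G s → Fin s → Clique G (pred s)
delete {s = suc _} C t = record
  { vertex    = vertex C ∘ punchIn t
  ; injective = punchIn-injective t _ _ ∘ injective C
  ; adjacent  = λ i≢j → adjacent C (i≢j ∘ punchIn-injective t _ _)
  }

delete-⊆ : {G : Graph N} (C : Clique G s) (t : Fin s) →
  (∀ i → X (vertex C i)) → ∀ i → X (vertex (delete C t) i)
delete-⊆ {s = suc _} C t C⊆X = C⊆X ∘ punchIn t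

delete-adjacent : {G : Graph N} (C : Clique G s) (t : Fin s) →
  ∀ i → Adj G (vertex C t) (vertex (delete C t) i)
delete-adjacent {s = suc _} C t i = adjacent C (punchInᵢ≢i t i ∘ sym)

record K4Packing (G : Graph N) (I : Set) : Set where
  field
    vertex    : I × Fin 4 → Fin N
    injective : Injective _≡_ _≡_ vertex
    adjacent  : ∀ {i j j′} → j ≢ j′ → Adj G (vertex (i , j)) (vertex (i , j′))
open K4Packing

packing : {G : Graph N} (C : Clique G s) → q * 4 ≤ s → K4Packing G (Fin q)
packing C q*4≤s = record
  { vertex    = λ (i , j) → vertex C (block i j)
  ; injective = λ eq → let i≡i′ , j≡j′ = block-injective (injective C eq) in
                       cong₂ _,_ i≡i′ j≡j′
  ; adjacent  = λ j≢j′ → adjacent C (j≢j′ ∘ proj₂ ∘ block-injective)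
  }
  where
  block : Fin _ → Fin 4 → Fin _
  block i j = inject≤ (combine i j) q*4≤s
  block-injective : ∀ {i j i′ j′} → block i j ≡ block i′ j′ → i ≡ i′ × j ≡ j′
  block-injective {i} {j} {i′} {j′} = combine-injective i j i′ j′ ∘ inject≤-injective q*4≤s q*4≤s _ _

disjoint-union : {G : Graph N} (P : K4Packing G I) (Q : K4Packing G J) →
  (∀ x y → vertex P x ≢ vertex Q y) → K4Packing G (I ⊎ J)
disjoint-union {I = I} {J = J} {G = G} P Q P#Q =
  record { vertex = v ; injective = v-injective ; adjacent = λ {i} → v-adjacent {i} }
  where
  v : (I ⊎ J) × Fin 4 → Fin _
  v (inj₁ i , j) = vertex P (i , j)
  v (inj₂ i , j) = vertex Q (i , j)
  v-injective : Injective _≡_ _≡_ v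
  v-injective {inj₁ _ , _} {inj₁ _ , _} eq = cong (map₁ inj₁) (injective P eq)
  v-injective {inj₁ _ , _} {inj₂ _ , _} eq = contradiction eq (P#Q _ _)
  v-injective {inj₂ _ , _} {inj₁ _ , _} eq = contradiction (sym eq) (P#Q _ _)
  v-injective {inj₂ _ , _} {inj₂ _ , _} eq = cong (map₁ inj₂) (injective Q eq)
  v-adjacent : ∀ {i j j′} → j ≢ j′ → Adj G (v (i , j)) (v (i , j′))
  v-adjacent {inj₁ i} = adjacent P {i}
  v-adjacent {inj₂ i} = adjacent Q {i}

reindex : {G : Graph N} (f : J → I) → Injective _≡_ _≡_ f → K4Packing G I → K4Packing G J
reindex f f-injective P = record
  { vertex    = λ (i , j) → vertex P (f i , j)
  ; injective = λ eq → let e = injective P eq in cong₂ _,_ (f-injective (,-injectiveˡ e)) (,-injectiveʳ e)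
  ; adjacent  = adjacent P
  }

fan : {G : Graph N} {n : ℕ} (c : Fin N) (P : K4Packing G (Fin n)) →
  (∀ x → Adj G c (vertex P x)) → ContainsFan G n
fan {G = G} c P c~P = f , f-injective , f-adjacent
  where
  f : FanV _ → Fin _
  f (inj₁ tt) = c
  f (inj₂ x)  = vertex P x
  f-injective : Injective _≡_ _≡_ f
  f-injective {inj₁ tt} {inj₁ tt} _  = refl
  f-injective {inj₁ tt} {inj₂ y}  eq = contradiction eq (adjacent⇒≢ G (c~P y))
  f-injective {inj₂ x}  {inj₁ tt} eq = contradiction (sym eq) (adjacent⇒≢ G (c~P x))
  f-injective {inj₂ x}  {inj₂ y}  eq = cong inj₂ (injective P eq)
  f-adjacent : ∀ x y → FanAdj x y → Adj G (f x) (f y)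
  f-adjacent _ (inj₂ y) centre-l = c~P y
  f-adjacent (inj₂ x) _ centre-r = Graph.sym G (c~P x)
  f-adjacent _ _ (clique j≢j′)   = adjacent P j≢j′

fan-of-cliques : {G : Graph N} {n : ℕ} (c : Fin N) (C : Clique G s) (D : Clique G t) →
  (∀ i j → vertex C i ≢ vertex D j) →
  (∀ i → Adj G c (vertex C i)) → (∀ j → Adj G c (vertex D j)) →
  p * 4 ≤ s → q * 4 ≤ t → n ≤ p + q → ContainsFan G n
fan-of-cliques {p = p} {q = q} {G = G} c C D C#D c~C c~D p*4≤s q*4≤t n≤p+q =
  fan c (reindex embed embed-injective C⊎D) (λ (i , j) → c~C⊎D (embed i , j))
  where
  C⊎D = disjoint-union (packing C p*4≤s) (packing D q*4≤t) (λ _ _ → C#D _ _)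
  c~C⊎D : ∀ x → Adj G c (vertex C⊎D x)
  c~C⊎D (inj₁ _ , _) = c~C _
  c~C⊎D (inj₂ _ , _) = c~D _
  embed : Fin _ → Fin p ⊎ Fin q
  embed i = splitAt p (inject≤ i n≤p+q)
  embed-injective : Injective _≡_ _≡_ embed
  embed-injective = inject≤-injective n≤p+q n≤p+q _ _ ∘ Injection.injective (↔⇒↣ (+↔⊎ {p} {q}))

-- P, Q and S need not be decidable (they will be adjacency). Call x covered when, for
-- some partner y, choose itself picks its first alternative: that is decidable and
-- implies P x, and if neither x nor y is covered, choose must have picked S x y.
module Trichotomy {N : ℕ} {X Y P Q : Pred (Fin N) 0ℓ} {S : Rel (Fin N) 0ℓ}
  (X? : Decidable X) (Y? : Decidable Y)
  (choose : ∀ {x y} → X x → Y y → P x ⊎ Q y ⊎ S x y) where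

  private
    verdict : ∀ {x y} → Dec (X x) → Dec (Y y) → Maybe (P x ⊎ Q y ⊎ S x y)
    verdict (yes x∈X) (yes y∈Y) = just (choose x∈X y∈Y)
    verdict _         _         = nothing

    first : ∀ {x y} → Maybe (P x ⊎ Q y ⊎ S x y) → Maybe (P x)
    first m = m >>= isInj₁

    second : ∀ {x y} → Maybe (P x ⊎ Q y ⊎ S x y) → Maybe (Q y)
    second m = m >>= isInj₂ >>= isInj₁

    third : ∀ {x y} (v : P x ⊎ Q y ⊎ S x y) →
      ¬ T (is-just (first (just v))) → ¬ T (is-just (second (just v))) → S x y
    third (inj₁ _)        ¬first _       = contradiction tt ¬first
    third (inj₂ (inj₁ _)) _      ¬second = contradiction tt ¬second
    third (inj₂ (inj₂ s)) _      _       = s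

  Covered₁ : Pred (Fin N) 0ℓ
  Covered₁ x = Any (λ y → T (is-just (first (verdict (X? x) (Y? y))))) (allFin N)

  Covered₂ : Pred (Fin N) 0ℓ
  Covered₂ y = Any (λ x → T (is-just (second (verdict (X? x) (Y? y))))) (allFin N)

  covered₁? : Decidable Covered₁
  covered₁? x = any? (λ y → T? _) (allFin N)

  covered₂? : Decidable Covered₂
  covered₂? y = any? (λ x → T? _) (allFin N)

  covered₁⇒P : ∀ {x} → Covered₁ x → P x
  covered₁⇒P c = let y , t = satisfied c in to-witness-T _ t

  covered₂⇒Q : ∀ {y} → Covered₂ y → Q y
  covered₂⇒Q c = let x , t = satisfied c in to-witness-T _ t

  uncovered⇒S : ∀ {x y} → X x → Y y → ¬ Covered₁ x → ¬ Covered₂ y → S x y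
  uncovered⇒S {x} {y} x∈X y∈Y ¬c₁ ¬c₂ =
    from-verdict (X? x) (Y? y) (¬c₁ ∘ lose (∈-allFin y)) (¬c₂ ∘ lose (∈-allFin x))
    where
    from-verdict : (x? : Dec (X x)) (y? : Dec (Y y)) →
      ¬ T (is-just (first (verdict x? y?))) → ¬ T (is-just (second (verdict x? y?))) → S x y
    from-verdict (yes x∈X′) (yes y∈Y′) = third (choose x∈X′ y∈Y′)
    from-verdict (no x∉X)   _          = contradiction x∈X x∉X
    from-verdict (yes _)    (no y∉Y)   = contradiction y∈Y y∉Y

  uncovered₁? : Decidable (X ∩ ∁ Covered₁)
  uncovered₁? = X? ∩? ∁? covered₁?

  uncovered₂? : Decidable (Y ∩ ∁ Covered₂)
  uncovered₂? = Y? ∩? ∁? covered₂?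

  covered-or-uncovered-pair :
    (∀ {x} → X x → P x) ⊎ (∀ {y} → Y y → Q y) ⊎ (∃ (X ∩ ∁ Covered₁) × ∃ (Y ∩ ∁ Covered₂))
  covered-or-uncovered-pair with any? uncovered₁? (allFin N) | any? uncovered₂? (allFin N)
  ... | no none₁ | _ = inj₁ λ {x} x∈X →
    covered₁⇒P (decidable-stable (covered₁? x) (λ ¬c → none₁ (lose (∈-allFin x) (x∈X , ¬c))))
  ... | yes _ | no none₂ = inj₂ (inj₁ λ {y} y∈Y →
    covered₂⇒Q (decidable-stable (covered₂? y) (λ ¬c → none₂ (lose (∈-allFin y) (y∈Y , ¬c)))))
  ... | yes some₁ | yes some₂ = inj₂ (inj₂ (satisfied some₁ , satisfied some₂))

isClique-∩ : {G : Graph N} {X Y : Pred (Fin N) 0ℓ} → IsClique G X → IsClique G (X ∩ Y)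
isClique-∩ X-clique u v = X-clique (proj₁ u) (proj₁ v)

fan-centred-in-clique : {G : Graph N} {r : ℕ} {a : Fin N} (X? : Decidable X) → IsClique G X →
  5 + r * 4 ≤ count X? → X a → (D : Clique G t) → 4 ≤ t →
  (∀ j → ¬ X (vertex D j)) → (∀ j → Adj G a (vertex D j)) → ContainsFan G (2 + r)
fan-centred-in-clique {X = X} {G = G} {r = r} X? X-clique |X| a∈X D 4≤t D∩X=∅ a~D =
  fan-of-cliques {p = 1} {q = suc r} _ D C∖a
    (λ j k eq → D∩X=∅ j (subst X (sym eq) (delete-⊆ {X = X} C i (enumerate-∈ X?) k)))
    a~D (λ k → subst (λ c → Adj G c (vertex C∖a k)) vi≡a (delete-adjacent C i k))
    4≤t (pred-mono-≤ |X|) ≤-refl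
  where
  C = cliqueOf X? X-clique
  i = proj₁ (enumerate-surjective X? a∈X)
  vi≡a = proj₂ (enumerate-surjective X? a∈X)
  C∖a = delete C i

class-size-bound : ∀ r {k} → k ≤ 3 → 5 + r * 4 ≤ 4 * (2 + r) ∸ k
class-size-bound r {k} k≤3 = begin
  5 + r * 4               ≡⟨ sym (m+n∸m≡n 3 _) ⟩
  3 + (5 + r * 4) ∸ 3     ≡⟨ cong (_∸ 3) (sym (4*[2+r]≡3+[5+r*4] r)) ⟩
  4 * (2 + r) ∸ 3         ≤⟨ ∸-monoʳ-≤ (4 * (2 + r)) k≤3 ⟩
  4 * (2 + r) ∸ k         ∎
  where
  open ≤-Reasoning
  4*[2+r]≡3+[5+r*4] : ∀ r → 4 * (2 + r) ≡ 3 + (5 + r * 4)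
  4*[2+r]≡3+[5+r*4] = solve-∀

count-∩-lower-bound : ∀ {N x} {X P : Pred (Fin N) 0ℓ} m (X? : Decidable X) (P? : Decidable P) →
  m + x ≤ count X? → count (X? ∩? ∁? P?) ≤ m → x ≤ count (X? ∩? P?)
count-∩-lower-bound {x = x} m X? P? m+x≤|X| |X∖P|≤m = +-cancelˡ-≤ m x _ (begin
  m + x                                  ≤⟨ m+x≤|X| ⟩
  count X?                               ≡⟨ count-split X? P? ⟩
  count (X? ∩? P?) + count (X? ∩? ∁? P?) ≤⟨ +-monoʳ-≤ (count (X? ∩? P?)) |X∖P|≤m ⟩
  count (X? ∩? P?) + m                   ≡⟨ +-comm _ m ⟩
  m + count (X? ∩? P?)                   ∎)
  where open ≤-Reasoning

module Neighbourhood {N : ℕ} (G : Graph N) (part : Fin N → Fin 3) (α≤2 : IndepAtMost2 G)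
  (V₁-clique : IsClique G (λ v → part v ≡ zero)) (V₂-clique : IsClique G (λ v → part v ≡ suc zero))
  (w : Fin N) (w∈V₃ : part w ≡ suc (suc zero)) where

  V₁? : Decidable (λ v → part v ≡ zero)
  V₁? v = part v ≟ zero

  V₂? : Decidable (λ v → part v ≡ suc zero)
  V₂? v = part v ≟ suc zero

  different-classes : ∀ {u v i j} → part u ≡ i → part v ≡ j → i ≢ j → u ≢ v
  different-classes u∈Vᵢ v∈Vⱼ i≢j refl = i≢j (trans (sym u∈Vᵢ) v∈Vⱼ)

  open Trichotomy V₁? V₂? (λ {x} {y} x∈V₁ y∈V₂ → α≤2 w x y (different-classes w∈V₃ x∈V₁ λ ())
    (different-classes w∈V₃ y∈V₂ λ ()) (different-classes x∈V₁ y∈V₂ λ ()))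

  U₁ : Clique G (count uncovered₁?)
  U₁ = cliqueOf uncovered₁? (isClique-∩ {G = G} {Y = ∁ Covered₁} V₁-clique)

  U₂ : Clique G (count uncovered₂?)
  U₂ = cliqueOf uncovered₂? (isClique-∩ {G = G} {Y = ∁ Covered₂} V₂-clique)

  W₁ : Clique G (count (V₁? ∩? covered₁?))
  W₁ = cliqueOf (V₁? ∩? covered₁?) (isClique-∩ {G = G} {Y = Covered₁} V₁-clique)

  W₂ : Clique G (count (V₂? ∩? covered₂?))
  W₂ = cliqueOf (V₂? ∩? covered₂?) (isClique-∩ {G = G} {Y = Covered₂} V₂-clique)

  uncovered-pair⇒fan : ∀ {r} → 2 ≤ r → 5 + r * 4 ≤ count V₁? → 5 + r * 4 ≤ count V₂? →
    ∀ {a b} → part a ≡ zero → ¬ Covered₁ a → part b ≡ suc zero → ¬ Covered₂ b → ContainsFan G (2 + r)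
  uncovered-pair⇒fan {r} 2≤r |V₁| |V₂| a∈V₁ ¬a b∈V₂ ¬b
    with 4 ≤? count uncovered₂? | 4 ≤? count uncovered₁?
  ... | yes 4≤|U₂| | _ =
    fan-centred-in-clique V₁? V₁-clique |V₁| a∈V₁ U₂ 4≤|U₂|
      (λ j a′∈V₁ → different-classes a′∈V₁ (proj₁ (U₂-∈ j)) (λ ()) refl)
      (λ j → uncovered⇒S a∈V₁ (proj₁ (U₂-∈ j)) ¬a (proj₂ (U₂-∈ j)))
    where U₂-∈ = enumerate-∈ uncovered₂?
  ... | no _ | yes 4≤|U₁| =
    fan-centred-in-clique V₂? V₂-clique |V₂| b∈V₂ U₁ 4≤|U₁|
      (λ i b′∈V₂ → different-classes (proj₁ (U₁-∈ i)) b′∈V₂ (λ ()) refl)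
      (λ i → Graph.sym G (uncovered⇒S (proj₁ (U₁-∈ i)) b∈V₂ (proj₂ (U₁-∈ i)) ¬b))
    where U₁-∈ = enumerate-∈ uncovered₁?
  ... | no 4≰|U₂| | no 4≰|U₁| =
    fan-of-cliques {p = 2} {q = r} w W₂ W₁
      (λ j i → different-classes (proj₁ (W₂-∈ j)) (proj₁ (W₁-∈ i)) (λ ()))
      (covered₂⇒Q ∘ proj₂ ∘ W₂-∈) (covered₁⇒P ∘ proj₂ ∘ W₁-∈)
      (≤-trans (*-monoˡ-≤ 4 2≤r) (few-uncovered V₂? covered₂? |V₂| 4≰|U₂|))
      (few-uncovered V₁? covered₁? |V₁| 4≰|U₁|) ≤-refl
    where
    W₁-∈ = enumerate-∈ (V₁? ∩? covered₁?)
    W₂-∈ = enumerate-∈ (V₂? ∩? covered₂?)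
    few-uncovered : ∀ {X P : Pred (Fin N) 0ℓ} (X? : Decidable X) (P? : Decidable P) →
      5 + r * 4 ≤ count X? → ¬ 4 ≤ count (X? ∩? ∁? P?) → r * 4 ≤ count (X? ∩? P?)
    few-uncovered X? P? |X| 4≰|X∖P| =
      ≤-trans (m≤n+m _ 2) (count-∩-lower-bound 3 X? P? |X| (s≤s⁻¹ (≰⇒> 4≰|X∖P|)))

  adjacent-to-V₁-or-V₂ : ∀ {r} → 2 ≤ r → 5 + r * 4 ≤ count V₁? → 5 + r * 4 ≤ count V₂? →
    ¬ ContainsFan G (2 + r) →
    (∀ v → part v ≡ zero → Adj G w v) ⊎ (∀ v → part v ≡ suc zero → Adj G w v)
  adjacent-to-V₁-or-V₂ 2≤r |V₁| |V₂| no-fan with covered-or-uncovered-pair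
  ... | inj₁ w~V₁        = inj₁ λ _ → w~V₁
  ... | inj₂ (inj₁ w~V₂) = inj₂ λ _ → w~V₂
  ... | inj₂ (inj₂ ((a , a∈V₁ , ¬a) , (b , b∈V₂ , ¬b))) =
    ⊥-elim (no-fan (uncovered-pair⇒fan 2≤r |V₁| |V₂| a∈V₁ ¬a b∈V₂ ¬b))

lemma2p3 : (n k : ℕ) → 4 ≤ n → 1 ≤ k → k ≤ 3 →
    (N : ℕ) (G : Graph N) (part : Fin N → Fin 3) →
    InducesComplete G part zero (4 * n ∸ k) →
    InducesComplete G part (suc zero) (4 * n ∸ k) →
    IndepAtMost2 G →
    ¬ ContainsFan G n →
    ∀ (w : Fin N) → part w ≡ suc (suc zero) →
      (∀ v → part v ≡ zero → Adj G w v) ⊎ (∀ v → part v ≡ suc zero → Adj G w v)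
lemma2p3 (suc (suc r)) k (s≤s (s≤s 2≤r)) _ k≤3 N G part
         (|V₁| , V₁-clique) (|V₂| , V₂-clique) α≤2 no-fan w w∈V₃ =
  Neighbourhood.adjacent-to-V₁-or-V₂ G part α≤2 (V₁-clique _ _) (V₂-clique _ _) w w∈V₃
    2≤r (size |V₁|) (size |V₂|) no-fan
  where
  size : ∀ {m} → m ≡ 4 * (2 + r) ∸ k → 5 + r * 4 ≤ m
  size m≡ = ≤-trans (class-size-bound r k≤3) (≤-reflexive (sym m≡))
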